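{- Let $p$ be a prime number such that $g=p+1$ is an even integer with $g\ge4$. Then there is no primitive number $m\neq g-1$ with $o_g(m)<g$.
   Context: For an odd integer $m\ge1$, an extreme cycle for the digit set $\{0,m\}$ (with respect to the even integer $g\ge 4$) is a finite set of distinct integers $\{x_0,\dots,x_{r-1}\}$ together with digits $l_0,\dots,l_{r-1}\in\{0,m\}$ such that $x_{j+1}=(x_j+l_j)/g$ for $0\le j\le r-2$ and $x_0=(x_{r-1}+l_{r-1})/g$. The cycle $\{0\}$ is the trivial extreme cycle. The odd number $m$ is complete if the only extreme cycle for $\{0,m\}$ is the trivial one, and incomplete otherwise. An odd number $m$ is primitive if it is incomplete and every proper divisor of $m$ is complete; it is a non-trivial primitive number if moreover $m\neq g-1$. Primitive numbers are coprime to $g$, and $o_g(m)$ denotes the order of $g$ in $U(\mathbb{Z}_m)$. -}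

module Defs where

open import Data.Nat using (ℕ; zero; suc; _∸_; _^_; _≤_; _<_)
open import Data.Nat.Divisibility using (_∣_)
open import Data.Nat.Properties using ()
open import Data.Integer using (ℤ; +_) renaming (_+_ to _+ℤ_; _*_ to _*ℤ_)
open import Data.Sum using (_⊎_)
open import Data.Product using (_×_)
open import Relation.Nullary using (¬_)
open import Relation.Binary.PropositionalEquality using (_≡_; _≢_)

Odd : ℕ → Set
Odd m = ¬ (2 ∣ m)

Even : ℕ → Set
Even m = 2 ∣ m

-- An extreme cycle for the digit set {0, m} with respect to base g:
-- distinct integers x 0, …, x (r-1) (r ≥ 1) and digits l 0, …, l (r-1) ∈ {0, m}
-- with x (j+1) = (x j + l j) / g for j ≤ r-2 and x 0 = (x (r-1) + l (r-1)) / g.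
-- Exact division over ℤ is written multiplicatively: g * x (j+1) = x j + l j.
-- Only the values at indices < r matter.
record ExtremeCycle (g m : ℕ) : Set where
  field
    r        : ℕ
    r≥1      : 1 ≤ r
    x        : ℕ → ℤ
    l        : ℕ → ℤ
    digit    : ∀ j → j < r → (l j ≡ + 0) ⊎ (l j ≡ + m)
    step     : ∀ j → suc j < r → (+ g) *ℤ x (suc j) ≡ x j +ℤ l j
    close    : (+ g) *ℤ x 0 ≡ x (r ∸ 1) +ℤ l (r ∸ 1)
    distinct : ∀ i j → i < r → j < r → x i ≡ x j → i ≡ j

Trivial : ∀ {g m} → ExtremeCycle g m → Set
Trivial C = ∀ j → j < ExtremeCycle.r C → ExtremeCycle.x C j ≡ + 0

Complete : ℕ → ℕ → Set
Complete g m = (C : ExtremeCycle g m) → Trivial C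

Incomplete : ℕ → ℕ → Set
Incomplete g m = ¬ Complete g m

Primitive : ℕ → ℕ → Set
Primitive g m = Odd m × Incomplete g m × (∀ d → d ∣ m → d ≢ m → Complete g d)

IsOrder : ℕ → ℕ → ℕ → Set
IsOrder g m k = 1 ≤ k × m ∣ (g ^ k ∸ 1) × (∀ k′ → 1 ≤ k′ → m ∣ (g ^ k′ ∸ 1) → k ≤ k′)

-- Let x₀, …, x_{r−1} be an extreme cycle for {0, m} in base g = p + 1.  At its minimum and at its
-- maximum the relation g xⱼ = xᵢ + lᵢ gives 0 ≤ xⱼ and p xⱼ ≤ m, so the cycle lies in [0, m/p].
-- Since gⁿ xₙ ≡ x₀ (mod m), if k = o_g(m) < r then x_k = x₀, contradicting distinctness; hence
-- r ≤ k ≤ p.  Summing the cycle relation gives p Σ x = s m, where s ≤ r counts the digits equal to m.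
-- The number g − 1 = p is incomplete (it has the cycle {1}), so p ∤ m for the primitive m ≠ p, and
-- p being prime forces p ∣ s: either s = 0 and the cycle is {0}, or s = r = p, Σ x = m, and then
-- every p xⱼ = m, so p ∣ m after all.  Thus m would be complete.
module Submission where

open import Defs
open import Data.Nat as ℕ using (ℕ; zero; suc; _∸_; _^_; _≤_; _<_; z≤n; s≤s; z<s; s<s; NonZero)
import Data.Nat.Properties as ℕP
open import Data.Nat.Divisibility using (_∣_; divides; _∣0; ∣⇒≤)
open import Data.Nat.Primality using (Prime; euclidsLemma; prime⇒nonZero; prime⇒nonTrivial)
open import Data.Integer as ℤ using (ℤ; +_; +[1+_]; -[1+_]; 0ℤ; _+_; _-_; _*_; ∣_∣)
import Data.Integer.Properties as ℤP
open import Data.Integer.Tactic.RingSolver using (solve-∀)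
open import Data.Fin using (toℕ; fromℕ; inject₁)
open import Data.Fin.Properties using (toℕ<n; toℕ-fromℕ; toℕ-inject₁)
open import Data.List using (upTo)
import Data.List.Relation.Unary.All as All
open import Data.List.Relation.Unary.All.Properties using (all-upTo)
open import Data.List.Membership.Propositional.Properties using (∈-upTo⁺)
open import Data.List.Extrema ℤP.≤-totalOrder
  using (argmin; argmax; argmin-all; argmax-all; f[argmin]≤f[xs]; f[xs]≤f[argmax])
open import Algebra.Properties.Semiring.Sum ℤP.+-*-semiring
  using (sum-syntax; sum-init-last; sum-cong-≗; ∑-distrib-+; *-distribˡ-sum; sum-replicate-zero)
open import Data.Sum using (_⊎_; inj₁; inj₂)
open import Data.Product using (_×_; _,_; proj₁; proj₂; ∃-syntax)
open import Function using (_∘_)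
open import Relation.Nullary using (¬_; contradiction)
open import Relation.Binary.PropositionalEquality
  using (_≡_; _≢_; refl; sym; trans; cong; cong₂; subst; module ≡-Reasoning)

+-≤-≡ : ∀ {a b c d : ℤ} → a ℤ.≤ c → b ℤ.≤ d → a + b ≡ c + d → a ≡ c × b ≡ d
+-≤-≡ a≤c b≤d eq =
  ℤP.≤-antisym a≤c (ℤP.≮⇒≥ λ a<c → ℤP.<⇒≢ (ℤP.+-mono-<-≤ a<c b≤d) eq) ,
  ℤP.≤-antisym b≤d (ℤP.≮⇒≥ λ b<d → ℤP.<⇒≢ (ℤP.+-mono-≤-< a≤c b<d) eq)

∑-mono-≤ : ∀ n {f h : ℕ → ℤ} → (∀ j → j < n → f j ℤ.≤ h j) →
           ∑[ i < n ] f (toℕ i) ℤ.≤ ∑[ i < n ] h (toℕ i)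
∑-mono-≤ zero    f≤h = ℤP.≤-refl
∑-mono-≤ (suc n) f≤h = ℤP.+-mono-≤ (f≤h 0 z<s) (∑-mono-≤ n (λ j j<n → f≤h (suc j) (s<s j<n)))

∑-≤∧≡⇒≡ : ∀ n {f h : ℕ → ℤ} → (∀ j → j < n → f j ℤ.≤ h j) →
          ∑[ i < n ] f (toℕ i) ≡ ∑[ i < n ] h (toℕ i) → ∀ j → j < n → f j ≡ h j
∑-≤∧≡⇒≡ (suc n) f≤h eq with +-≤-≡ (f≤h 0 z<s) (∑-mono-≤ n (λ j j<n → f≤h (suc j) (s<s j<n))) eq
... | f₀≡h₀ , tail≡ = λ { zero _ → f₀≡h₀
                        ; (suc j) (s<s j<n) → ∑-≤∧≡⇒≡ n (λ i i<n → f≤h (suc i) (s<s i<n)) tail≡ j j<n }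

∑-const : ∀ n c → ∑[ i < n ] c ≡ + n * c
∑-const zero    c = sym (ℤP.*-zeroˡ c)
∑-const (suc n) c = trans (cong (_+_ c) (∑-const n c)) (sym (ℤP.suc-* (+ n) c))

∑-rotate : ∀ r (f h : ℕ → ℤ) → 1 ≤ r → f 0 ≡ h (r ∸ 1) → (∀ j → suc j < r → f (suc j) ≡ h j) →
           ∑[ i < r ] f (toℕ i) ≡ ∑[ i < r ] h (toℕ i)
∑-rotate (suc n) f h _ f₀≡hₙ f≡h = begin
  f 0 + ∑[ i < n ] f (suc (toℕ i))               ≡⟨ cong₂ _+_ f₀≡hₙ (sum-cong-≗ (λ i → f≡h (toℕ i) (s<s (toℕ<n i)))) ⟩
  h n + ∑[ i < n ] h (toℕ i)                     ≡⟨ ℤP.+-comm (h n) _ ⟩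
  ∑[ i < n ] h (toℕ i) + h n                     ≡⟨ sym (cong₂ _+_ (sum-cong-≗ {n} (cong h ∘ toℕ-inject₁)) (cong h (toℕ-fromℕ n))) ⟩
  ∑[ i < n ] h (toℕ (inject₁ i)) + h (toℕ (fromℕ n)) ≡⟨ sym (sum-init-last {n} (h ∘ toℕ)) ⟩
  ∑[ i < suc n ] h (toℕ i)                       ∎
  where open ≡-Reasoning

∑-digits : ∀ {m} n (l : ℕ → ℤ) → (∀ j → j < n → l j ≡ + 0 ⊎ l j ≡ + m) →
           ∃[ s ] s ≤ n × ∑[ i < n ] l (toℕ i) ≡ + (s ℕ.* m)
∑-digits zero l _ = 0 , z≤n , refl
∑-digits {m} (suc n) l digit with ∑-digits n (l ∘ suc) (λ j j<n → digit (suc j) (s<s j<n)) | digit 0 z<s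
... | s , s≤n , ∑≡ | inj₁ l₀≡0 = s , ℕP.m≤n⇒m≤1+n s≤n , trans (cong₂ _+_ l₀≡0 ∑≡) (ℤP.+-identityˡ _)
... | s , s≤n , ∑≡ | inj₂ l₀≡m = suc s , s≤s s≤n , trans (cong₂ _+_ l₀≡m ∑≡) (sym (ℤP.pos-+ m (s ℕ.* m)))

minimiser : ∀ (f : ℕ → ℤ) {n} → 0 < n → ∃[ j ] j < n × ∀ i → i < n → f j ℤ.≤ f i
minimiser f {n} 0<n = argmin f 0 (upTo n) , argmin-all f 0<n (all-upTo n) ,
  λ i i<n → All.lookup (f[argmin]≤f[xs] {f = f} 0 (upTo n)) (∈-upTo⁺ i<n)

maximiser : ∀ (f : ℕ → ℤ) {n} → 0 < n → ∃[ j ] j < n × ∀ i → i < n → f i ℤ.≤ f j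
maximiser f {n} 0<n = argmax f 0 (upTo n) , argmax-all f 0<n (all-upTo n) ,
  λ i i<n → All.lookup (f[xs]≤f[argmax] {f = f} 0 (upTo n)) (∈-upTo⁺ i<n)

p*[b+km]≰m : ∀ {p m n} {b : ℤ} → 1 < p → .{{NonZero m}} → 0ℤ ℤ.≤ b →
             ¬ (+ p * (b + +[1+ n ] * + m) ℤ.≤ + m)
p*[b+km]≰m {p} {m} {n} {b} 1<p 0≤b ≤m = ℤP.<-irrefl refl (begin-strict
  + m                        <⟨ ℤ.+<+ (ℕP.m<m*n m p 1<p) ⟩
  + (m ℕ.* p)                ≡⟨ trans (ℤP.pos-* m p) (ℤP.*-comm (+ m) (+ p)) ⟩
  + p * + m                  ≤⟨ ℤP.*-monoˡ-≤-nonNeg (+ p) m≤b+km ⟩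
  + p * (b + +[1+ n ] * + m) ≤⟨ ≤m ⟩
  + m                        ∎)
  where
  open ℤP.≤-Reasoning
  m≤km : + m ℤ.≤ +[1+ n ] * + m
  m≤km = subst (+ m ℤ.≤_) (ℤP.pos-* (suc n) m) (ℤ.+≤+ (ℕP.m≤m+n m (n ℕ.* m)))
  m≤b+km : + m ℤ.≤ b + +[1+ n ] * + m
  m≤b+km = ℤP.+-mono-≤ 0≤b m≤km

bounded-congruent⇒≡ : ∀ {p m} {a b : ℤ} → 1 < p → .{{NonZero m}} → 0ℤ ℤ.≤ a → 0ℤ ℤ.≤ b →
                      + p * a ℤ.≤ + m → + p * b ℤ.≤ + m → ∀ e → a ≡ b + e * + m → a ≡ b
bounded-congruent⇒≡ _   _   _   _ _    (+ 0)      a≡b+0 = trans a≡b+0 (ℤP.+-identityʳ _)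
bounded-congruent⇒≡ 1<p _   0≤b pa≤m _ +[1+ n ] refl  = contradiction pa≤m (p*[b+km]≰m {n = n} 1<p 0≤b)
bounded-congruent⇒≡ {p} {m} {a} {b} 1<p 0≤a _ _ pb≤m -[1+ n ] a≡b-km =
  contradiction (subst (λ v → + p * v ℤ.≤ + m) b≡a+km pb≤m) (p*[b+km]≰m {n = n} 1<p 0≤a)
  where
  cancel : ∀ b c M → b ≡ (b + (ℤ.- c) * M) + c * M
  cancel = solve-∀
  b≡a+km : b ≡ a + +[1+ n ] * + m
  b≡a+km = trans (cancel b +[1+ n ] (+ m)) (cong (_+ +[1+ n ] * + m) (sym a≡b-km))

1+p*y≡a+b⇒p*y≡a-y+b : ∀ p (y a b : ℤ) → + suc p * y ≡ a + b → + p * y ≡ (a - y) + b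
1+p*y≡a+b⇒p*y≡a-y+b p y a b gy≡a+b = begin
  + p * y                 ≡⟨ peel (+ p) y ⟩
  (+ 1 + + p) * y - y     ≡⟨ cong (_- y) gy≡a+b ⟩
  (a + b) - y             ≡⟨ regroup a b y ⟩
  (a - y) + b             ∎
  where
  open ≡-Reasoning
  peel : ∀ P y → P * y ≡ (+ 1 + P) * y - y
  peel = solve-∀
  regroup : ∀ a b y → (a + b) - y ≡ (a - y) + b
  regroup = solve-∀

*-nonNeg⇒nonNeg : ∀ p .{{_ : NonZero p}} {y : ℤ} → 0ℤ ℤ.≤ + p * y → 0ℤ ℤ.≤ y
*-nonNeg⇒nonNeg p {y} 0≤py = ℤP.*-cancelˡ-≤-pos 0ℤ y (+ p) (subst (ℤ._≤ + p * y) (sym (ℤP.*-zeroʳ (+ p))) 0≤py)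
  where
  instance
    +p-positive : ℤ.Positive (+ p)
    +p-positive = ℤ.positive (ℤ.+<+ (ℕ.>-nonZero⁻¹ p))

p*a≡b⇒p∣b : ∀ p {a : ℤ} {b} → 0ℤ ℤ.≤ a → + p * a ≡ + b → p ∣ b
p*a≡b⇒p∣b p {a} {b} 0≤a pa≡b = divides ∣ a ∣ (ℤP.+-injective (begin
  + b              ≡⟨ sym pa≡b ⟩
  + p * a          ≡⟨ cong (+ p *_) (sym (ℤP.0≤i⇒+∣i∣≡i 0≤a)) ⟩
  + p * + ∣ a ∣    ≡⟨ sym (ℤP.pos-* p ∣ a ∣) ⟩
  + (p ℕ.* ∣ a ∣)  ≡⟨ cong +_ (ℕP.*-comm p ∣ a ∣) ⟩
  + (∣ a ∣ ℕ.* p)  ∎))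
  where open ≡-Reasoning

p∣s∧s≤p⇒s≡0⊎s≡p : ∀ {p s} → p ∣ s → s ≤ p → s ≡ 0 ⊎ s ≡ p
p∣s∧s≤p⇒s≡0⊎s≡p {s = zero}  _   _   = inj₁ refl
p∣s∧s≤p⇒s≡0⊎s≡p {s = suc _} p∣s s≤p = inj₂ (ℕP.≤-antisym s≤p (∣⇒≤ p∣s))

module ExtremeCycleProperties {p m : ℕ} .{{_ : NonZero p}} (C : ExtremeCycle (suc p) m) where
  open ExtremeCycle C

  g : ℕ
  g = suc p

  predecessor : ∀ j → j < r → ∃[ i ] i < r × + g * x j ≡ x i + l i
  predecessor zero    _   = r ∸ 1 , ℕP.∸-monoʳ-< z<s r≥1 , close
  predecessor (suc j) j<r = j , ℕP.<-trans (ℕP.n<1+n j) j<r , step j j<r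

  digit-range : ∀ j → j < r → 0ℤ ℤ.≤ l j × l j ℤ.≤ + m
  digit-range j j<r with digit j j<r
  ... | inj₁ l≡0 rewrite l≡0 = ℤP.≤-refl , ℤ.+≤+ z≤n
  ... | inj₂ l≡m rewrite l≡m = ℤ.+≤+ z≤n , ℤP.≤-refl

  excess : ∀ j → j < r → ∃[ i ] i < r × + p * x j ≡ (x i - x j) + l i
  excess j j<r with predecessor j j<r
  ... | i , i<r , gxⱼ≡xᵢ+lᵢ = i , i<r , 1+p*y≡a+b⇒p*y≡a-y+b p (x j) (x i) (l i) gxⱼ≡xᵢ+lᵢ

  minimum-nonNeg : ∀ j → j < r → (∀ i → i < r → x j ℤ.≤ x i) → 0ℤ ℤ.≤ x j
  minimum-nonNeg j j<r xⱼ≤ with excess j j<r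
  ... | i , i<r , pxⱼ≡ = *-nonNeg⇒nonNeg p (begin
    0ℤ                 ≤⟨ ℤP.+-mono-≤ (ℤP.i≤j⇒0≤j-i (xⱼ≤ i i<r)) (proj₁ (digit-range i i<r)) ⟩
    (x i - x j) + l i  ≡⟨ sym pxⱼ≡ ⟩
    + p * x j          ∎)
    where open ℤP.≤-Reasoning

  maximum-bounded : ∀ j → j < r → (∀ i → i < r → x i ℤ.≤ x j) → + p * x j ℤ.≤ + m
  maximum-bounded j j<r ≤xⱼ with excess j j<r
  ... | i , i<r , pxⱼ≡ = begin
    + p * x j          ≡⟨ pxⱼ≡ ⟩
    (x i - x j) + l i  ≤⟨ ℤP.+-mono-≤ (ℤP.i≤j⇒i-j≤0 (≤xⱼ i i<r)) (proj₂ (digit-range i i<r)) ⟩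
    + m                ∎
    where open ℤP.≤-Reasoning

  nonNeg : ∀ j → j < r → 0ℤ ℤ.≤ x j
  nonNeg j j<r with minimiser x r≥1
  ... | jₘ , jₘ<r , xₘ≤ = ℤP.≤-trans (minimum-nonNeg jₘ jₘ<r xₘ≤) (xₘ≤ j j<r)

  bounded : ∀ j → j < r → + p * x j ℤ.≤ + m
  bounded j j<r with maximiser x r≥1
  ... | jₘ , jₘ<r , ≤xₘ = ℤP.≤-trans (ℤP.*-monoˡ-≤-nonNeg (+ p) (≤xₘ j j<r)) (maximum-bounded jₘ jₘ<r ≤xₘ)

  digit-multiple : ∀ j → j < r → ∃[ d ] l j ≡ d * + m
  digit-multiple j j<r with digit j j<r
  ... | inj₁ l≡0 = 0ℤ , trans l≡0 (sym (ℤP.*-zeroˡ (+ m)))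
  ... | inj₂ l≡m = + 1 , trans l≡m (sym (ℤP.*-identityˡ (+ m)))

  power-congruence : ∀ n → n < r → ∃[ q ] + (g ^ n) * x n ≡ x 0 + q * + m
  power-congruence zero    _    = 0ℤ , trans (ℤP.*-identityˡ (x 0)) (sym (ℤP.+-identityʳ (x 0)))
  power-congruence (suc n) 1+n<r
    with power-congruence n (ℕP.<-trans (ℕP.n<1+n n) 1+n<r) | digit-multiple n (ℕP.<-trans (ℕP.n<1+n n) 1+n<r)
  ... | q , gⁿxₙ≡ | d , lₙ≡dm = q + A * d , (begin
    + (g ^ suc n) * x (suc n)     ≡⟨ cong (_* x (suc n)) (ℤP.pos-* g (g ^ n)) ⟩
    (+ g * A) * x (suc n)         ≡⟨ reassoc (+ g) A (x (suc n)) ⟩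
    A * (+ g * x (suc n))         ≡⟨ cong (A *_) (step n 1+n<r) ⟩
    A * (x n + l n)               ≡⟨ cong (λ v → A * (x n + v)) lₙ≡dm ⟩
    A * (x n + d * + m)           ≡⟨ distrib A (x n) d (+ m) ⟩
    A * x n + A * d * + m         ≡⟨ cong (_+ A * d * + m) gⁿxₙ≡ ⟩
    (x 0 + q * + m) + A * d * + m ≡⟨ collect (x 0) q (A * d) (+ m) ⟩
    x 0 + (q + A * d) * + m       ∎)
    where
    open ≡-Reasoning
    A = + (g ^ n)
    reassoc : ∀ G A y → (G * A) * y ≡ A * (G * y)
    reassoc = solve-∀
    distrib : ∀ A y d M → A * (y + d * M) ≡ A * y + A * d * M
    distrib = solve-∀
    collect : ∀ x₀ q e M → (x₀ + q * M) + e * M ≡ x₀ + (q + e) * M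
    collect = solve-∀

  length≤order : 1 < p → .{{NonZero m}} → ∀ {k} → 1 ≤ k → m ∣ g ^ k ∸ 1 → r ≤ k
  length≤order 1<p {k} 1≤k (divides t gᵏ∸1≡tm) = ℕP.≮⇒≥ k≮r
    where
    T M : ℤ
    T = + t
    M = + m
    gᵏ≡1+tm : + (g ^ k) ≡ + 1 + T * M
    gᵏ≡1+tm = begin
      + (g ^ k)             ≡⟨ cong +_ (sym (ℕP.suc-pred (g ^ k) {{ℕP.m^n≢0 g k}})) ⟩
      + suc (g ^ k ∸ 1)     ≡⟨ cong (+_ ∘ suc) gᵏ∸1≡tm ⟩
      + 1 + + (t ℕ.* m)     ≡⟨ cong (_+_ (+ 1)) (ℤP.pos-* t m) ⟩
      + 1 + T * M           ∎
      where open ≡-Reasoning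
    k≮r : ¬ k < r
    k≮r k<r with power-congruence k k<r
    ... | q , gᵏxₖ≡ = ℕP.<⇒≢ 1≤k (sym (distinct k 0 k<r 0<r xₖ≡x₀))
      where
      open ≡-Reasoning
      0<r : 0 < r
      0<r = ℕP.≤-<-trans z≤n k<r
      split : ∀ T M y → y ≡ (+ 1 + T * M) * y - T * y * M
      split = solve-∀
      collect : ∀ x₀ q e M → (x₀ + q * M) - e * M ≡ x₀ + (q - e) * M
      collect = solve-∀
      xₖ≡x₀+em : x k ≡ x 0 + (q - T * x k) * M
      xₖ≡x₀+em = begin
        x k                              ≡⟨ split T M (x k) ⟩
        (+ 1 + T * M) * x k - T * x k * M ≡⟨ cong (λ v → v * x k - T * x k * M) (sym gᵏ≡1+tm) ⟩
        + (g ^ k) * x k - T * x k * M    ≡⟨ cong (_- T * x k * M) gᵏxₖ≡ ⟩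
        (x 0 + q * M) - T * x k * M      ≡⟨ collect (x 0) q (T * x k) M ⟩
        x 0 + (q - T * x k) * M          ∎
      xₖ≡x₀ : x k ≡ x 0
      xₖ≡x₀ = bounded-congruent⇒≡ 1<p (nonNeg k k<r) (nonNeg 0 0<r) (bounded k k<r) (bounded 0 0<r) (q - T * x k) xₖ≡x₀+em

  X L : ℤ
  X = ∑[ i < r ] x (toℕ i)
  L = ∑[ i < r ] l (toℕ i)

  p*X≡L : + p * X ≡ L
  p*X≡L = begin
    + p * X          ≡⟨ 1+p*y≡a+b⇒p*y≡a-y+b p X X L gX≡X+L ⟩
    (X - X) + L      ≡⟨ cong (_+ L) (ℤP.+-inverseʳ X) ⟩
    0ℤ + L           ≡⟨ ℤP.+-identityˡ L ⟩
    L                ∎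
    where
    open ≡-Reasoning
    gX≡X+L : + g * X ≡ X + L
    gX≡X+L = begin
      + g * X                         ≡⟨ *-distribˡ-sum {r} (+ g) (x ∘ toℕ) ⟩
      ∑[ i < r ] (+ g * x (toℕ i))    ≡⟨ ∑-rotate r (λ j → + g * x j) (λ j → x j + l j) r≥1 close step ⟩
      ∑[ i < r ] (x (toℕ i) + l (toℕ i)) ≡⟨ ∑-distrib-+ {r} (x ∘ toℕ) (l ∘ toℕ) ⟩
      X + L                           ∎

  pX≡0⇒trivial : + p * X ≡ 0ℤ → Trivial C
  pX≡0⇒trivial pX≡0 j j<r = sym (∑-≤∧≡⇒≡ r nonNeg (trans (sum-replicate-zero r) (sym X≡0)) j j<r)
    where
    X≡0 : X ≡ 0ℤ
    X≡0 = ℤP.*-cancelˡ-≡ (+ p) X 0ℤ (trans pX≡0 (sym (ℤP.*-zeroʳ (+ p))))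

  pX≡pm⇒p∣m : r ≡ p → + p * X ≡ + p * + m → p ∣ m
  pX≡pm⇒p∣m r≡p pX≡pm = p*a≡b⇒p∣b p (nonNeg 0 r≥1) (∑-≤∧≡⇒≡ r bounded ∑px≡∑m 0 r≥1)
    where
    open ≡-Reasoning
    ∑px≡∑m : ∑[ i < r ] (+ p * x (toℕ i)) ≡ ∑[ i < r ] (+ m)
    ∑px≡∑m = begin
      ∑[ i < r ] (+ p * x (toℕ i)) ≡⟨ sym (*-distribˡ-sum {r} (+ p) (x ∘ toℕ)) ⟩
      + p * X                      ≡⟨ pX≡pm ⟩
      + p * + m                    ≡⟨ cong (λ n → + n * + m) (sym r≡p) ⟩
      + r * + m                    ≡⟨ sym (∑-const r (+ m)) ⟩
      ∑[ i < r ] (+ m)             ∎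

  digit-count : ∃[ s ] s ≤ r × + p * X ≡ + (s ℕ.* m)
  digit-count with ∑-digits r l digit
  ... | s , s≤r , L≡sm = s , s≤r , trans p*X≡L L≡sm

  X-nonNeg : 0ℤ ℤ.≤ X
  X-nonNeg = subst (ℤ._≤ X) (sum-replicate-zero r) (∑-mono-≤ r nonNeg)

  short-cycle-trivial : Prime p → ¬ p ∣ m → r ≤ p → Trivial C
  short-cycle-trivial p-prime p∤m r≤p with digit-count
  ... | s , s≤r , pX≡sm with euclidsLemma s m p-prime (p*a≡b⇒p∣b p X-nonNeg pX≡sm)
  ... | inj₂ p∣m = contradiction p∣m p∤m
  ... | inj₁ p∣s with p∣s∧s≤p⇒s≡0⊎s≡p p∣s (ℕP.≤-trans s≤r r≤p)
  ... | inj₁ refl = pX≡0⇒trivial pX≡sm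
  ... | inj₂ refl = contradiction (pX≡pm⇒p∣m (ℕP.≤-antisym r≤p s≤r) (trans pX≡sm (ℤP.pos-* p m))) p∤m

unit-cycle : ∀ p → ExtremeCycle (suc p) p
unit-cycle p = record
  { r        = 1
  ; r≥1      = s≤s z≤n
  ; x        = λ _ → + 1
  ; l        = λ _ → + p
  ; digit    = λ _ _ → inj₂ refl
  ; step     = λ { _ (s≤s ()) }
  ; close    = ℤP.*-identityʳ (+ suc p)
  ; distinct = λ { zero zero _ _ _ → refl ; (suc _) _ (s≤s ()) _ _ ; zero (suc _) _ (s≤s ()) _ }
  }

theorem4p8p1 : (p : ℕ) → Prime p → Even (suc p) → 4 ≤ suc p →
    (m : ℕ) → Primitive (suc p) m → m ≢ suc p ∸ 1 →
    (k : ℕ) → IsOrder (suc p) m k → ¬ (k < suc p)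
theorem4p8p1 p p-prime _ _ m (odd , incomplete , divisors-complete) m≢p k (1≤k , m∣gᵏ∸1 , _) k<g =
  incomplete λ C → let open ExtremeCycleProperties C in
    short-cycle-trivial p-prime p∤m (ℕP.≤-trans (length≤order 1<p 1≤k m∣gᵏ∸1) (ℕP.≤-pred k<g))
  where
  instance
    p≢0 : NonZero p
    p≢0 = prime⇒nonZero p-prime
    m≢0 : NonZero m
    m≢0 = ℕ.≢-nonZero λ { refl → odd (2 ∣0) }
  1<p : 1 < p
  1<p = ℕ.nonTrivial⇒n>1 p {{prime⇒nonTrivial p-prime}}
  p∤m : ¬ p ∣ m
  p∤m p∣m = contradiction (divisors-complete p p∣m (m≢p ∘ sym) (unit-cycle p) 0 (s≤s z≤n)) λ ()
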